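{- Let $N$ be a positive integer and let $p$ be a polyomino with at least $2$ cells. If $S$ is a set of cells of minimum size among all sets of cells which contain at least $N$ instances of $p$, then $S$ is connected.
   Context: Cells are the unit squares of the square lattice, indexed by integer coordinates $(x,y)$; two cells are adjacent if they share an edge. A polyomino is a finite nonempty edge-connected set of cells; its size is its number of cells. Polyominoes are considered only up to translation (fixed polyominoes): the shape of a set of cells is its equivalence class under translations. For a polyomino shape $p$, an instance of $p$ is any set of cells that is a translate of $p$; an instance of $p$ in a set of cells $S$ is an instance of $p$ that is a subset of $S$. The size of a set of cells is its number of cells, and a set of cells is connected if it is edge-connected. -}

module Defs where

open import Data.Integer using (ℤ; _+_; 1ℤ; -1ℤ; 0ℤ)
open import Data.Nat using (ℕ; _≤_)
open import Data.Product using (_×_; Σ; ∃; _,_)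
open import Data.Sum using (_⊎_)
open import Data.List using (List; []; _∷_; map; length)
open import Data.List.Membership.Propositional using (_∈_)
open import Data.List.Relation.Unary.All using (All)
open import Data.List.Relation.Unary.AllPairs using (AllPairs)
open import Data.List.Relation.Unary.Unique.Propositional using (Unique)
open import Relation.Binary.PropositionalEquality using (_≡_)
open import Relation.Nullary using (¬_)

Cell : Set
Cell = ℤ × ℤ

_+ᶜ_ : Cell → Cell → Cell
(a , b) +ᶜ (c , d) = (a + c , b + d)

Adjacent : Cell → Cell → Set
Adjacent a b = (b ≡ a +ᶜ (1ℤ , 0ℤ)) ⊎ (b ≡ a +ᶜ (-1ℤ , 0ℤ))
             ⊎ (b ≡ a +ᶜ (0ℤ , 1ℤ)) ⊎ (b ≡ a +ᶜ (0ℤ , -1ℤ))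

-- A finite set of cells is represented by a duplicate-free list;
-- its size is then the length of the list.
-- Set-theoretic notions on lists of cells (as sets):
_⊆ᶜ_ : List Cell → List Cell → Set
A ⊆ᶜ B = ∀ {c} → c ∈ A → c ∈ B

SameSet : List Cell → List Cell → Set
SameSet A B = (A ⊆ᶜ B) × (B ⊆ᶜ A)

data Walk (S : List Cell) : Cell → Cell → Set where
  stop : ∀ {a} → a ∈ S → Walk S a a
  step : ∀ {a b c} → a ∈ S → Adjacent a b → Walk S b c → Walk S a c

Connected : List Cell → Set
Connected S = ∀ {a b} → a ∈ S → b ∈ S → Walk S a b

-- A polyomino: finite nonempty edge-connected set of cells
-- (a representative of its translation class).
IsPolyomino : List Cell → Set
IsPolyomino p = Unique p × (∃ λ c → c ∈ p) × Connected p

translate : Cell → List Cell → List Cell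
translate t A = map (_+ᶜ t) A

IsInstance : List Cell → List Cell → Set
IsInstance p I = ∃ λ t → SameSet I (translate t p)

InstanceIn : List Cell → List Cell → List Cell → Set
InstanceIn p S I = IsInstance p I × (I ⊆ᶜ S)

HasInstances : ℕ → List Cell → List Cell → Set
HasInstances N p S =
  Σ (List (List Cell)) λ Is →
    (N ≤ length Is) × All (InstanceIn p S) Is × AllPairs (λ I J → ¬ SameSet I J) Is

{-# OPTIONS --safe #-}
-- Suppose a minimal S is disconnected, and split it into the connected component K of
-- some cell and the rest. Every instance of p is connected, hence lies entirely inside K
-- or entirely outside it. Translate the outside part so that its lexicographically least
-- cell lands on the lexicographically greatest cell of the inside part; since the
-- lexicographic order is translation invariant, that is the only cell where the two parts
-- meet. The merged set is one cell smaller, and mapping each instance along with its part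
-- keeps distinct instances distinct: an inside instance equal to a translated outside one
-- would consist of the single meeting cell only, while p has two cells. This contradicts
-- minimality.
module Submission where

open import Defs
open import Data.Nat using (ℕ; _≤_)
open import Data.List using (List; length)
open import Data.List.Relation.Unary.Unique.Propositional using (Unique)

open import Level using (0ℓ)
open import Algebra.Bundles using (AbelianGroup; Group)
import Algebra.Construct.DirectProduct as DirectProduct
open import Data.Integer as ℤ using ()
import Data.Integer.Properties as ℤ
open import Data.Nat as ℕ using (zero; suc; _<_; _+_)
import Data.Nat.Properties as ℕ
open import Data.List using ([]; _∷_; map; filter; _++_)
open import Data.List.Properties using (length-map; length-++; filter-notAll; map-∘; map-cong)
open import Data.List.Membership.Propositional using (_∈_; _∉_; find; lose)
open import Data.List.Membership.Propositional.Properties using (∈-map⁺; ∈-map⁻; ∈-filter⁺; ∈-filter⁻; ∈-++⁺ˡ; ∈-++⁺ʳ)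
open import Data.List.Relation.Binary.Subset.Propositional.Properties using () renaming (map⁺ to ⊆-map⁺)
open import Data.List.Relation.Unary.All as All using (All; []; _∷_; all?)
open import Data.List.Relation.Unary.All.Properties using (¬All⇒Any¬) renaming (map⁺ to All-map⁺)
open import Data.List.Relation.Unary.AllPairs using (AllPairs; []; _∷_)
import Data.List.Relation.Unary.AllPairs.Properties as AllPairs
open import Data.List.Relation.Unary.Any using (Any; here; there; any?)
import Data.List.Relation.Unary.Unique.Propositional.Properties as Unique
open import Data.Product using (_×_; Σ; ∃; _,_; proj₁; uncurry)
open import Data.Product.Properties using (≡-dec)
open import Data.Product.Relation.Binary.Lex.NonStrict using (×-totalOrder)
open import Data.Product.Relation.Binary.Pointwise.NonDependent using (≡×≡⇒≡; ≡⇒≡×≡)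
open import Data.Sum as Sum using (_⊎_; inj₁; inj₂; [_,_]′)
open import Function using (_∘_; id)
open import Relation.Binary.Bundles using (TotalOrder)
open import Relation.Binary.Definitions using (DecidableEquality)
open import Relation.Binary.PropositionalEquality using (_≡_; _≢_; refl; sym; trans; cong; subst; module ≡-Reasoning)
open import Relation.Nullary using (Dec; yes; no; ¬_; ¬?; contradiction)
open import Relation.Nullary.Decidable using (_⊎-dec_)
open import Relation.Unary.Properties using (∁?)

-- Its operation is _+ᶜ_ up to η for pairs; its equality is pointwise ≡, undone by ≡×≡⇒≡.
cellGroup : AbelianGroup 0ℓ 0ℓ
cellGroup = DirectProduct.abelianGroup ℤ.+-0-abelianGroup ℤ.+-0-abelianGroup

open AbelianGroup cellGroup using (assoc; group; commutativeSemigroup)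
open Group group using (_\\_)
open import Algebra.Properties.AbelianGroup cellGroup using (∙-cancelʳ; \\-leftDividesˡ)
open import Algebra.Properties.CommutativeSemigroup commutativeSemigroup using (xy∙z≈xz∙y)
open import Algebra.Properties.AbelianGroup ℤ.+-0-abelianGroup using () renaming (∙-cancelʳ to ℤ-+-cancelʳ)

+ᶜ-assoc : ∀ c s t → (c +ᶜ s) +ᶜ t ≡ c +ᶜ (s +ᶜ t)
+ᶜ-assoc c s t = ≡×≡⇒≡ (assoc c s t)

+ᶜ-cancelʳ : ∀ t {c d} → c +ᶜ t ≡ d +ᶜ t → c ≡ d
+ᶜ-cancelʳ t eq = ≡×≡⇒≡ (∙-cancelʳ t _ _ (≡⇒≡×≡ eq))

c+ᶜ[c\\d]≡d : ∀ c d → c +ᶜ (c \\ d) ≡ d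
c+ᶜ[c\\d]≡d c d = ≡×≡⇒≡ (\\-leftDividesˡ c d)

infix 4 _≟ᶜ_
_≟ᶜ_ : DecidableEquality Cell
_≟ᶜ_ = ≡-dec ℤ._≟_ ℤ._≟_

open import Data.List.Membership.DecPropositional _≟ᶜ_ using (_∈?_)

adjacent? : ∀ c d → Dec (Adjacent c d)
adjacent? c d = d ≟ᶜ c +ᶜ (ℤ.1ℤ , ℤ.0ℤ) ⊎-dec d ≟ᶜ c +ᶜ (ℤ.-1ℤ , ℤ.0ℤ)
         ⊎-dec d ≟ᶜ c +ᶜ (ℤ.0ℤ , ℤ.1ℤ) ⊎-dec d ≟ᶜ c +ᶜ (ℤ.0ℤ , ℤ.-1ℤ)

adjacent-translate : ∀ t {c d} → Adjacent c d → Adjacent (c +ᶜ t) (d +ᶜ t)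
adjacent-translate t {c} = Sum.map move (Sum.map move (Sum.map move move))
  where
    move : ∀ {e d} → d ≡ c +ᶜ e → d +ᶜ t ≡ (c +ᶜ t) +ᶜ e
    move {e} refl = ≡×≡⇒≡ (xy∙z≈xz∙y c e t)

lexicographic : TotalOrder 0ℓ 0ℓ 0ℓ
lexicographic = ×-totalOrder ℤ.≤-decTotalOrder ℤ.≤-totalOrder

open TotalOrder lexicographic using () renaming (_≤_ to _≤ₗ_; antisym to ≤ₗ-antisym)
open import Data.List.Extrema lexicographic using (max; min; argmax-sel; argmin-sel; xs≤max; min≤xs)

≤ₗ-translate : ∀ t {c d} → c ≤ₗ d → c +ᶜ t ≤ₗ d +ᶜ t
≤ₗ-translate (u , v) (inj₁ (c₁≤d₁ , c₁≢d₁)) =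
  inj₁ (ℤ.+-monoˡ-≤ u c₁≤d₁ , c₁≢d₁ ∘ ℤ-+-cancelʳ u _ _)
≤ₗ-translate (u , v) (inj₂ (refl , c₂≤d₂)) = inj₂ (refl , ℤ.+-monoˡ-≤ v c₂≤d₂)

walk-source : ∀ {S a b} → Walk S a b → a ∈ S
walk-source (stop a∈S) = a∈S
walk-source (step a∈S _ _) = a∈S

walk-snoc : ∀ {S a b c} → Walk S a b → Adjacent b c → c ∈ S → Walk S a c
walk-snoc (stop b∈S) b~c c∈S = step b∈S b~c (stop c∈S)
walk-snoc (step a∈S a~a′ w) b~c c∈S = step a∈S a~a′ (walk-snoc w b~c c∈S)

walk-mono : ∀ {A B a b} → A ⊆ᶜ B → Walk A a b → Walk B a b
walk-mono A⊆B (stop a∈A) = stop (A⊆B a∈A)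
walk-mono A⊆B (step a∈A a~a′ w) = step (A⊆B a∈A) a~a′ (walk-mono A⊆B w)

walk-translate : ∀ t {A a b} → Walk A a b → Walk (translate t A) (a +ᶜ t) (b +ᶜ t)
walk-translate t (stop a∈A) = stop (∈-map⁺ (_+ᶜ t) a∈A)
walk-translate t {a = a} (step {b = a′} a∈A a~a′ w) =
  step (∈-map⁺ (_+ᶜ t) a∈A) (adjacent-translate t {a} {a′} a~a′) (walk-translate t w)

walk-preserves : ∀ {S} (P : Cell → Set) → (∀ {c d} → P c → d ∈ S → Adjacent c d → P d) →
                 ∀ {a b} → Walk S a b → P a → P b
walk-preserves P step-P (stop _) Pa = Pa
walk-preserves P step-P (step _ a~a′ w) Pa = walk-preserves P step-P w (step-P Pa (walk-source w) a~a′)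

instance-connected : ∀ {p I} → Connected p → IsInstance p I → Connected I
instance-connected p-connected (t , I⊆p+t , p+t⊆I) c∈I d∈I
  with ∈-map⁻ (_+ᶜ t) (I⊆p+t c∈I) | ∈-map⁻ (_+ᶜ t) (I⊆p+t d∈I)
... | u , u∈p , refl | v , v∈p , refl = walk-mono p+t⊆I (walk-translate t (p-connected u∈p v∈p))

∈-translate⁻ : ∀ t {c A} → c +ᶜ t ∈ translate t A → c ∈ A
∈-translate⁻ t c+t∈A+t with ∈-map⁻ (_+ᶜ t) c+t∈A+t
... | d , d∈A , c+t≡d+t = subst (_∈ _) (sym (+ᶜ-cancelʳ t c+t≡d+t)) d∈A

translate-translate : ∀ s t A → translate t (translate s A) ≡ translate (s +ᶜ t) A
translate-translate s t A = trans (sym (map-∘ A)) (map-cong (λ c → +ᶜ-assoc c s t) A)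

SameSet-translate⁺ : ∀ t {A B} → SameSet A B → SameSet (translate t A) (translate t B)
SameSet-translate⁺ t (A⊆B , B⊆A) = ⊆-map⁺ (_+ᶜ t) A⊆B , ⊆-map⁺ (_+ᶜ t) B⊆A

SameSet-translate⁻ : ∀ t {A B} → SameSet (translate t A) (translate t B) → SameSet A B
SameSet-translate⁻ t (A+t⊆B+t , B+t⊆A+t) =
  ∈-translate⁻ t ∘ A+t⊆B+t ∘ ∈-map⁺ (_+ᶜ t) , ∈-translate⁻ t ∘ B+t⊆A+t ∘ ∈-map⁺ (_+ᶜ t)

IsInstance-translate : ∀ t {p I} → IsInstance p I → IsInstance p (translate t I)
IsInstance-translate t {p} (s , I≈p+s) =
  s +ᶜ t , subst (SameSet _) (translate-translate s t p) (SameSet-translate⁺ t I≈p+s)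

instance-⊈-singleton : ∀ {p I} m → Unique p → 2 ≤ length p → IsInstance p I → ¬ I ⊆ᶜ (m ∷ [])
instance-⊈-singleton {[]} m _ () _
instance-⊈-singleton {_ ∷ []} m _ (ℕ.s≤s ()) _
instance-⊈-singleton {u ∷ v ∷ ps} m ((u≢v ∷ _) ∷ _) _ (t , _ , p+t⊆I) I⊆[m] =
  u≢v (+ᶜ-cancelʳ t (trans (≡m (here refl)) (sym (≡m (there (here refl))))))
  where
    ≡m : ∀ {c} → c ∈ translate t (u ∷ v ∷ ps) → c ≡ m
    ≡m c∈ with I⊆[m] (p+t⊆I c∈)
    ... | here c≡m = c≡m

delete : Cell → List Cell → List Cell
delete d = filter (λ c → ¬? (c ≟ᶜ d))

∈-delete⁺ : ∀ {c d xs} → c ∈ xs → c ≢ d → c ∈ delete d xs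
∈-delete⁺ = ∈-filter⁺ (λ c → ¬? (c ≟ᶜ _))

∈-delete⁻ : ∀ {c d xs} → c ∈ delete d xs → c ∈ xs × c ≢ d
∈-delete⁻ = ∈-filter⁻ (λ c → ¬? (c ≟ᶜ _))

length-delete : ∀ {d xs} → d ∈ xs → length (delete d xs) < length xs
length-delete {d} {xs} d∈xs = filter-notAll (λ c → ¬? (c ≟ᶜ d)) xs (lose d∈xs (λ d≢d → d≢d refl))

Unique-delete : ∀ d {xs} → Unique xs → Unique (delete d xs)
Unique-delete d = Unique.filter⁺ (λ c → ¬? (c ≟ᶜ d))

length-filter+length-filter-∁ : ∀ {A : Set} {P : A → Set} (P? : ∀ x → Dec (P x)) xs →
  length (filter P? xs) + length (filter (∁? P?) xs) ≡ length xs
length-filter+length-filter-∁ P? [] = refl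
length-filter+length-filter-∁ P? (x ∷ xs) with P? x
... | yes _ = cong suc (length-filter+length-filter-∁ P? xs)
... | no _ = trans (ℕ.+-suc _ _) (cong suc (length-filter+length-filter-∁ P? xs))

allPairs-mapWithAll : ∀ {A : Set} {Q : A → Set} {R T : A → A → Set} →
  (∀ {x y} → Q x → Q y → R x y → T x y) → ∀ {xs} → All Q xs → AllPairs R xs → AllPairs T xs
allPairs-mapWithAll f [] [] = []
allPairs-mapWithAll f (qx ∷ qxs) (rx ∷ rxs) =
  All.zipWith (uncurry (f qx)) (qxs , rx) ∷ allPairs-mapWithAll f qxs rxs

HasInstances-map : ∀ {N p S S′} (f : List Cell → List Cell) →
  (∀ {I} → InstanceIn p S I → InstanceIn p S′ (f I)) →
  (∀ {I J} → InstanceIn p S I → InstanceIn p S J → ¬ SameSet I J → ¬ SameSet (f I) (f J)) →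
  HasInstances N p S → HasInstances N p S′
HasInstances-map {N} f f-in f-distinct (Is , N≤|Is| , Is-in , Is-distinct) =
  map f Is ,
  subst (N ≤_) (sym (length-map f Is)) N≤|Is| ,
  All-map⁺ (All.map f-in Is-in) ,
  AllPairs.map⁺ (allPairs-mapWithAll f-distinct Is-in Is-distinct)

AdjacencyClosed : List Cell → List Cell → Set
AdjacencyClosed S K = ∀ {c d} → c ∈ K → d ∈ S → Adjacent c d → d ∈ K

record Component (S : List Cell) (a : Cell) : Set where
  field
    cells     : List Cell
    a∈cells   : a ∈ cells
    reachable : ∀ {c} → c ∈ cells → Walk S a c
    closed    : AdjacencyClosed S cells

record Exploration (S : List Cell) (a : Cell) : Set where
  field
    visited     : List Cell
    unvisited   : List Cell
    a∈visited   : a ∈ visited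
    reachable   : ∀ {c} → c ∈ visited → Walk S a c
    covers      : ∀ {c} → c ∈ S → c ∈ visited ⊎ c ∈ unvisited
    unvisited⊆S : unvisited ⊆ᶜ S

  Frontier : Set
  Frontier = Any (λ d → Any (λ c → Adjacent c d) visited) unvisited

  frontier? : Dec Frontier
  frontier? = any? (λ d → any? (λ c → adjacent? c d) visited) unvisited

open Exploration

start : ∀ {S a} → a ∈ S → Exploration S a
start {S} {a} a∈S = record
  { visited = a ∷ [] ; unvisited = S ; a∈visited = here refl
  ; reachable = λ { (here refl) → stop a∈S } ; covers = inj₂ ; unvisited⊆S = id }

visit : ∀ {S a} (E : Exploration S a) → Frontier E →
        Σ (Exploration S a) λ E′ → length (unvisited E′) < length (unvisited E)
visit {S} {a} E frontier with find frontier
... | d , d∈U , adjacent-to-visited with find adjacent-to-visited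
... | c , c∈V , c~d = E′ , length-delete d∈U
  where
    reachable′ : ∀ {x} → x ∈ d ∷ visited E → Walk S a x
    reachable′ (here refl) = walk-snoc (reachable E c∈V) c~d (unvisited⊆S E d∈U)
    reachable′ (there x∈V) = reachable E x∈V

    covers′ : ∀ {x} → x ∈ S → x ∈ d ∷ visited E ⊎ x ∈ delete d (unvisited E)
    covers′ {x} x∈S with covers E x∈S | x ≟ᶜ d
    ... | inj₁ x∈V | _        = inj₁ (there x∈V)
    ... | inj₂ _   | yes refl = inj₁ (here refl)
    ... | inj₂ x∈U | no x≢d   = inj₂ (∈-delete⁺ x∈U x≢d)

    E′ : Exploration S a
    E′ = record
      { visited = d ∷ visited E ; unvisited = delete d (unvisited E)
      ; a∈visited = there (a∈visited E) ; reachable = reachable′ ; covers = covers′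
      ; unvisited⊆S = unvisited⊆S E ∘ proj₁ ∘ ∈-delete⁻ }

finish : ∀ {S a} (E : Exploration S a) → ¬ Frontier E → Component S a
finish {S} E no-frontier = record
  { cells = visited E ; a∈cells = a∈visited E ; reachable = reachable E ; closed = closed }
  where
    closed : AdjacencyClosed S (visited E)
    closed c∈V d∈S c~d with covers E d∈S
    ... | inj₁ d∈V = d∈V
    ... | inj₂ d∈U = contradiction (lose d∈U (lose c∈V c~d)) no-frontier

explore : ∀ {S a} n (E : Exploration S a) → length (unvisited E) < n → Component S a
explore zero E ()
explore (suc n) E |U|<1+n with frontier? E
... | no no-frontier = finish E no-frontier
... | yes frontier with visit E frontier
...   | E′ , shorter = explore n E′ (ℕ.<-≤-trans shorter (ℕ.s≤s⁻¹ |U|<1+n))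

component : ∀ {S a} → a ∈ S → Component S a
component {S} a∈S = explore (suc (length S)) (start a∈S) (ℕ.n<1+n (length S))

module Shift {S K : List Cell} (K-closed : AdjacencyClosed S K)
             {a b : Cell} (a∈S : a ∈ S) (a∈K : a ∈ K) (b∈S : b ∈ S) (b∉K : b ∉ K) where

  inner outer : List Cell
  inner = filter (_∈? K) S
  outer = filter (∁? (_∈? K)) S

  m r t : Cell
  m = max a inner
  r = min b outer
  t = r \\ m

  r+t≡m : r +ᶜ t ≡ m
  r+t≡m = c+ᶜ[c\\d]≡d r m

  m∈inner : m ∈ inner
  m∈inner = [ (λ m≡a → subst (_∈ inner) (sym m≡a) (∈-filter⁺ (_∈? K) a∈S a∈K)) , id ]′
              (argmax-sel id a inner)

  r∈outer : r ∈ outer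
  r∈outer = [ (λ r≡b → subst (_∈ outer) (sym r≡b) (∈-filter⁺ (∁? (_∈? K)) b∈S b∉K)) , id ]′
              (argmin-sel id b outer)

  -- c ≤ m = r + t ≤ d + t = c in the lexicographic order.
  meets-only-at-m : ∀ {c d} → c ∈ inner → d ∈ outer → c ≡ d +ᶜ t → c ≡ m
  meets-only-at-m {d = d} c∈inner d∈outer refl = ≡×≡⇒≡ (≤ₗ-antisym
    (All.lookup (xs≤max a inner) c∈inner)
    (subst (_≤ₗ d +ᶜ t) r+t≡m (≤ₗ-translate t (All.lookup (min≤xs b outer) d∈outer))))

  S′ : List Cell
  S′ = inner ++ translate t (delete r outer)

  S′-unique : Unique S → Unique S′
  S′-unique S-unique = Unique.++⁺
    (Unique.filter⁺ (_∈? K) S-unique)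
    (Unique.map⁺ (+ᶜ-cancelʳ t) (Unique-delete r (Unique.filter⁺ (∁? (_∈? K)) S-unique)))
    disjoint
    where
      disjoint : ∀ {c} → ¬ (c ∈ inner × c ∈ translate t (delete r outer))
      disjoint (c∈inner , c∈shifted) with ∈-map⁻ (_+ᶜ t) c∈shifted
      ... | d , d∈ , c≡d+t with ∈-delete⁻ d∈
      ... | d∈outer , d≢r = d≢r (+ᶜ-cancelʳ t (begin
        d +ᶜ t ≡⟨ sym c≡d+t ⟩
        _      ≡⟨ meets-only-at-m c∈inner d∈outer c≡d+t ⟩
        m      ≡⟨ sym r+t≡m ⟩
        r +ᶜ t ∎))
        where open ≡-Reasoning

  S′-shorter : length S′ < length S
  S′-shorter = begin-strict
    length S′
      ≡⟨ length-++ inner ⟩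
    length inner + length (translate t (delete r outer))
      ≡⟨ cong (length inner +_) (length-map _ (delete r outer)) ⟩
    length inner + length (delete r outer)
      <⟨ ℕ.+-monoʳ-< (length inner) (length-delete r∈outer) ⟩
    length inner + length outer
      ≡⟨ length-filter+length-filter-∁ (_∈? K) S ⟩
    length S
      ∎
    where open ℕ.≤-Reasoning

  translate-outer⊆S′ : translate t outer ⊆ᶜ S′
  translate-outer⊆S′ c∈ with ∈-map⁻ (_+ᶜ t) c∈
  ... | d , d∈outer , refl with d ≟ᶜ r
  ...   | yes refl = subst (_∈ S′) (sym r+t≡m) (∈-++⁺ˡ m∈inner)
  ...   | no d≢r = ∈-++⁺ʳ inner (∈-map⁺ (_+ᶜ t) (∈-delete⁺ d∈outer d≢r))

  ⊆inner : ∀ {I} → I ⊆ᶜ S → All (_∈ K) I → I ⊆ᶜ inner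
  ⊆inner I⊆S I⊆K c∈I = ∈-filter⁺ (_∈? K) (I⊆S c∈I) (All.lookup I⊆K c∈I)

  ⊆outer : ∀ {I} → Connected I → I ⊆ᶜ S → ¬ All (_∈ K) I → I ⊆ᶜ outer
  ⊆outer {I} I-connected I⊆S I⊈K c∈I with find (¬All⇒Any¬ (_∈? K) I I⊈K)
  ... | d , d∈I , d∉K = ∈-filter⁺ (∁? (_∈? K)) (I⊆S c∈I)
    (λ c∈K → d∉K (walk-preserves (_∈ K) K-closed (walk-mono I⊆S (I-connected c∈I d∈I)) c∈K))

  module _ {p : List Cell} (p-unique : Unique p) (2≤|p| : 2 ≤ length p)
           (p-connected : Connected p) where

    shift : List Cell → List Cell
    shift I with all? (_∈? K) I
    ... | yes _ = I
    ... | no _ = translate t I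

    shift-in : ∀ {I} → InstanceIn p S I → InstanceIn p S′ (shift I)
    shift-in {I} (I-instance , I⊆S) with all? (_∈? K) I
    ... | yes I⊆K = I-instance , ∈-++⁺ˡ ∘ ⊆inner I⊆S I⊆K
    ... | no I⊈K = IsInstance-translate t I-instance ,
      translate-outer⊆S′ ∘ ⊆-map⁺ (_+ᶜ t) (⊆outer (instance-connected p-connected I-instance) I⊆S I⊈K)

    inner-instance≉translate-outer : ∀ {I J} → IsInstance p I → I ⊆ᶜ inner → J ⊆ᶜ outer →
                                     ¬ SameSet I (translate t J)
    inner-instance≉translate-outer {I} I-instance I⊆inner J⊆outer (I⊆J+t , _) =
      instance-⊈-singleton m p-unique 2≤|p| I-instance (here ∘ ≡m)
      where
        ≡m : ∀ {c} → c ∈ I → c ≡ m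
        ≡m c∈I with ∈-map⁻ (_+ᶜ t) (I⊆J+t c∈I)
        ... | d , d∈J , c≡d+t = meets-only-at-m (I⊆inner c∈I) (J⊆outer d∈J) c≡d+t

    shift-distinct : ∀ {I J} → InstanceIn p S I → InstanceIn p S J →
                     ¬ SameSet I J → ¬ SameSet (shift I) (shift J)
    shift-distinct {I} {J} (I-instance , I⊆S) (J-instance , J⊆S) I≉J
      with all? (_∈? K) I | all? (_∈? K) J
    ... | yes _ | yes _ = I≉J
    ... | no _ | no _ = I≉J ∘ SameSet-translate⁻ t
    ... | yes I⊆K | no J⊈K = inner-instance≉translate-outer I-instance (⊆inner I⊆S I⊆K)
      (⊆outer (instance-connected p-connected J-instance) J⊆S J⊈K)
    ... | no I⊈K | yes J⊆K = λ (I+t⊆J , J⊆I+t) → inner-instance≉translate-outer J-instance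
      (⊆inner J⊆S J⊆K) (⊆outer (instance-connected p-connected I-instance) I⊆S I⊈K) (J⊆I+t , I+t⊆J)

    HasInstances-S′ : ∀ {N} → HasInstances N p S → HasInstances N p S′
    HasInstances-S′ = HasInstances-map shift shift-in shift-distinct

separated-set-shrinks : ∀ {N p S K a b} → IsPolyomino p → 2 ≤ length p → Unique S →
  AdjacencyClosed S K → a ∈ S → a ∈ K → b ∈ S → b ∉ K → HasInstances N p S →
  ∃ λ S′ → Unique S′ × HasInstances N p S′ × length S′ < length S
separated-set-shrinks (p-unique , _ , p-connected) 2≤|p| S-unique K-closed
                      a∈S a∈K b∈S b∉K S-instances =
  S′ , S′-unique S-unique , HasInstances-S′ p-unique 2≤|p| p-connected S-instances , S′-shorter
  where open Shift K-closed a∈S a∈K b∈S b∉K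

lemma2p1 : (N : ℕ) → 1 ≤ N → (p : List Cell) → IsPolyomino p → 2 ≤ length p →
    (S : List Cell) → Unique S → HasInstances N p S →
    ((S′ : List Cell) → Unique S′ → HasInstances N p S′ → length S ≤ length S′) →
    Connected S
lemma2p1 N _ p p-polyomino 2≤|p| S S-unique S-instances S-minimal {a} {b} a∈S b∈S
  with component a∈S
... | K with b ∈? Component.cells K
...   | yes b∈K = Component.reachable K b∈K
...   | no b∉K with separated-set-shrinks p-polyomino 2≤|p| S-unique (Component.closed K)
                      a∈S (Component.a∈cells K) b∈S b∉K S-instances
...     | S′ , S′-unique , S′-instances , S′<S =
  contradiction (S-minimal S′ S′-unique S′-instances) (ℕ.<⇒≱ S′<S)
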